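{- Let $G$ be an undirected graph and $k\in\mathbb{N}$. Let $\mathsf{conf}=(v_1,\dots,v_k)$ and $\mathsf{conf}'=(v'_1,\dots,v'_k)$ be $(G,k)$-configurations. Then $(\mathsf{conf},\mathsf{conf}')$ is a $(k-1)$-transition if and only if (1) for every $1\le i\le k-1$, $v'_i\notin\{v_1,v_2,\dots,v_i\}$, and (2) $v'_k=v_1$.
   Context: For an undirected graph $G$ and $k\in\mathbb{N}$, a $(G,k)$-configuration is a tuple $(v_1,\dots,v_k)$ of pairwise distinct vertices of $G$ with $\{v_i,v_{i+1}\}\in E(G)$ for $1\le i\le k-1$. A pair of configurations $((v_1,\dots,v_k),(v'_1,\dots,v'_k))$ is a $1$-transition if $v'_1\ne v_i$ for all $1\le i\le k-1$ and $v'_i=v_{i-1}$ for all $2\le i\le k$. For $\ell$, $(\mathsf{conf},\mathsf{conf}')$ is an $\ell$-transition if there exist configurations $\mathsf{conf}_1=\mathsf{conf},\dots,\mathsf{conf}_{\ell+1}=\mathsf{conf}'$ such that $(\mathsf{conf}_i,\mathsf{conf}_{i+1})$ is a $1$-transition for every $1\le i\le\ell$. -}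

module Defs where

open import Level using (Level; _⊔_; Lift)
open import Data.Nat using (ℕ; zero; suc; _<_; _≤_; _∸_)
open import Data.Fin using (Fin; toℕ)
open import Data.Product using (Σ; _×_)
open import Relation.Binary.PropositionalEquality using (_≡_; _≢_)
open import Relation.Nullary using (¬_)

record Graph (a b : Level) : Set (Level.suc (a ⊔ b)) where
  field
    Vertex : Set a
    Adj    : Vertex → Vertex → Set b
    sym    : ∀ {u v} → Adj u v → Adj v u
    irrefl : ∀ {u} → ¬ Adj u u

module _ {a b : Level} (G : Graph a b) where
  open Graph G

  -- A (G,k)-configuration (v_1,…,v_k), stored 0-based: index i : Fin k
  -- corresponds to v_{i+1}.
  record Configuration (k : ℕ) : Set (a ⊔ b) where
    field
      vertex   : Fin k → Vertex
      distinct : ∀ (i j : Fin k) → vertex i ≡ vertex j → i ≡ j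
      path     : ∀ (i j : Fin k) → toℕ j ≡ suc (toℕ i) → Adj (vertex i) (vertex j)
  open Configuration public

  OneTransition : {k : ℕ} → Configuration k → Configuration k → Set a
  OneTransition {k} c c' =
    (∀ (i j : Fin k) → toℕ j ≡ 0 → suc (toℕ i) < k → vertex c' j ≢ vertex c i)
    × (∀ (i j : Fin k) → toℕ j ≡ suc (toℕ i) → vertex c' j ≡ vertex c i)

  -- ℓ-transition: a chain conf_1 = conf, …, conf_{ℓ+1} = conf' of 1-transitions.
  -- Equality of configurations is equality of the vertex tuples.
  Transition : {k : ℕ} → ℕ → Configuration k → Configuration k → Set (a ⊔ b)
  Transition zero    c c' = Lift b (∀ i → vertex c i ≡ vertex c' i)
  Transition (suc ℓ) c c' = Σ (Configuration _) λ c'' → OneTransition c c'' × Transition ℓ c'' c'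

module Submission where

-- A configuration moves by 1-transitions like a snake: a fresh vertex
-- adjacent to the head is prepended and the tail vertex is dropped.
-- After ℓ such moves on k vertices (0-based indices) the state is described by
--   Shifted ℓ:     v'_{i+ℓ} = v_i        (the old body, shifted ℓ places), and
--   FreshPrefix ℓ: for i < ℓ, v'_i ∉ {v_0, …, v_{k+i-ℓ-1}}
--                  (when v'_i was prepended, these were the vertices it had
--                  to avoid, described in terms of the original c).  Then, by induction on ℓ, an ℓ-transition is
-- equivalent to Shifted ℓ ∧ FreshPrefix ℓ, for every ℓ < k.  Corollary 3.2
-- is the case ℓ = k - 1, where Shifted says v'_{k-1} = v_0 and FreshPrefix
-- says v'_i ∉ {v_0, …, v_i} for i < k - 1.

open import Defs
open import Level using (Level; lift)
open import Data.Nat using (ℕ; zero; suc; _<_; _≤_; _∸_; _+_; s≤s; s≤s⁻¹)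
open import Data.Nat.Properties
  using (+-suc; +-comm; +-monoˡ-<; +-cancelʳ-<; +-cancelʳ-≤; +-cancelˡ-≤; +-monoʳ-≤;
         +-identityʳ; ≤-refl; ≤-trans; <⇒≤; n≤1+n; <-irrefl; m+n≤o⇒m≤o; n≤0⇒n≡0; >⇒≢; m<1+n⇒m<n∨m≡n; suc-injective)
open import Data.Fin using (Fin; toℕ; fromℕ<; inject₁; lower₁) renaming (zero to fz; suc to fs)
open import Data.Fin.Properties
  using (toℕ-fromℕ<; toℕ-injective; toℕ-inject₁; inject₁ℕ<; inject₁-injective; inject₁-lower₁; toℕ<n)
open import Data.Empty using (⊥-elim)
open import Data.Product using (Σ; _×_; _,_)
open import Data.Sum using (inj₁; inj₂)
open import Function.Bundles using (_⇔_; mk⇔)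
open import Relation.Binary.PropositionalEquality
  using (_≡_; _≢_; refl; sym; trans; cong; subst)

+suc-< : ∀ {j m ℓ} → j < m → j + suc ℓ < suc m + ℓ
+suc-< {j} {m} {ℓ} j<m rewrite +-suc j ℓ = s≤s (+-monoˡ-< ℓ j<m)

+suc-<⁻¹ : ∀ {i j m ℓ} → i ≤ ℓ → j + suc ℓ < suc m + i → j < m
+suc-<⁻¹ {i} {j} {m} {ℓ} i≤ℓ lt =
  +-cancelʳ-< ℓ j m (s≤s⁻¹ (subst (_< suc m + ℓ) (+-suc j ℓ) (≤-trans lt (s≤s (+-monoʳ-≤ m i≤ℓ)))))

+suc<⇒< : ∀ {i m ℓ} → i + suc ℓ < suc m → i < m
+suc<⇒< {i} {m} {ℓ} lt = m+n≤o⇒m≤o (suc i) (s≤s⁻¹ (subst (_< suc m) (+-suc i ℓ) lt))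

≤⇒+-< : ∀ {i j m} → j ≤ i → j + m < suc m + i
≤⇒+-< {i} {j} {m} j≤i = s≤s (subst (_≤ m + i) (+-comm m j) (+-monoʳ-≤ m j≤i))

+-<⇒≤ : ∀ {i j m} → j + m < suc m + i → j ≤ i
+-<⇒≤ {i} {j} {m} lt = +-cancelˡ-≤ m j i (subst (_≤ m + i) (+-comm j m) (s≤s⁻¹ lt))

+-≤⇒0 : ∀ {i m} → i + m ≤ m → i ≡ 0
+-≤⇒0 {i} {m} le = n≤0⇒n≡0 (+-cancelʳ-≤ m i 0 le)

inject₁-+suc : ∀ {m} (j : Fin m) ℓ → toℕ (inject₁ j) + suc ℓ ≡ suc (toℕ j) + ℓ
inject₁-+suc j ℓ = trans (cong (_+ suc ℓ) (toℕ-inject₁ j)) (+-suc (toℕ j) ℓ)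

inject₁-preimage : ∀ {m} (i : Fin (suc m)) → toℕ i < m → Σ (Fin m) λ i₀ → inject₁ i₀ ≡ i
inject₁-preimage i lt = lower₁ i (>⇒≢ lt) , inject₁-lower₁ i (>⇒≢ lt)

module _ {a b : Level} (G : Graph a b) where
  open Graph G using (Vertex; Adj)

  oneTransition⇒shift : ∀ {m} {c c'' : Configuration G (suc m)} → OneTransition G c c'' →
    ∀ (i : Fin m) → vertex c'' (fs i) ≡ vertex c (inject₁ i)
  oneTransition⇒shift (_ , shift) i = shift (inject₁ i) (fs i) (cong suc (sym (toℕ-inject₁ i)))

  oneTransition⇒fresh : ∀ {m} {c c'' : Configuration G (suc m)} → OneTransition G c c'' →
    ∀ (i : Fin m) → vertex c'' fz ≢ vertex c (inject₁ i)
  oneTransition⇒fresh (fresh , _) i = fresh (inject₁ i) fz refl (s≤s (inject₁ℕ< i))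

  push : ∀ {m} (c : Configuration G (suc m)) (x : Vertex) →
    Adj x (vertex c fz) → (∀ (i : Fin m) → x ≢ vertex c (inject₁ i)) → Configuration G (suc m)
  push {m} c x adj fresh = record { vertex = pushed ; distinct = distinct′ ; path = path′ }
    where
      pushed : Fin (suc m) → Vertex
      pushed fz     = x
      pushed (fs i) = vertex c (inject₁ i)

      distinct′ : ∀ i j → pushed i ≡ pushed j → i ≡ j
      distinct′ fz     fz     _ = refl
      distinct′ fz     (fs j) e = ⊥-elim (fresh j e)
      distinct′ (fs i) fz     e = ⊥-elim (fresh i (sym e))
      distinct′ (fs i) (fs j) e = cong fs (inject₁-injective (distinct c _ _ e))

      path′ : ∀ i j → toℕ j ≡ suc (toℕ i) → Adj (pushed i) (pushed j)
      path′ fz     (fs fz)     refl = adj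
      path′ fz     (fs (fs j)) ()
      path′ (fs i) (fs j)      p    = path c (inject₁ i) (inject₁ j)
        (trans (toℕ-inject₁ j) (trans (suc-injective p) (cong suc (sym (toℕ-inject₁ i)))))

  push-oneTransition : ∀ {m} (c : Configuration G (suc m)) (x : Vertex) (adj : Adj x (vertex c fz))
    (fresh : ∀ (i : Fin m) → x ≢ vertex c (inject₁ i)) → OneTransition G c (push c x adj fresh)
  push-oneTransition {m} c x adj fresh = head-fresh , body-shifted
    where
      c'' : Configuration G (suc m)
      c'' = push c x adj fresh

      head-fresh : ∀ (i j : Fin (suc m)) → toℕ j ≡ 0 → suc (toℕ i) < suc m → vertex c'' j ≢ vertex c i
      head-fresh i fz     _  i<m with inject₁-preimage i (s≤s⁻¹ i<m)
      ... | i₀ , refl = fresh i₀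
      head-fresh i (fs j) () _

      body-shifted : ∀ (i j : Fin (suc m)) → toℕ j ≡ suc (toℕ i) → vertex c'' j ≡ vertex c i
      body-shifted i (fs j) p = cong (vertex c) (toℕ-injective (trans (toℕ-inject₁ j) (suc-injective p)))

  Shifted : ∀ {k} → ℕ → Configuration G k → Configuration G k → Set a
  Shifted {k} ℓ c c' = ∀ (i j : Fin k) → toℕ j ≡ toℕ i + ℓ → vertex c' j ≡ vertex c i

  FreshPrefix : ∀ {k} → ℕ → Configuration G k → Configuration G k → Set a
  FreshPrefix {k} ℓ c c' =
    ∀ (i j : Fin k) → toℕ i < ℓ → toℕ j + ℓ < k + toℕ i → vertex c' i ≢ vertex c j

  transition⇒shiftedFresh : ∀ {m} ℓ {c c' : Configuration G (suc m)} →
    Transition G ℓ c c' → Shifted ℓ c c' × FreshPrefix ℓ c c'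
  transition⇒shiftedFresh zero {c} {c'} (lift same) = shifted , λ _ _ ()
    where
      shifted : Shifted zero c c'
      shifted i j p = sym (trans (same i) (cong (vertex c') (toℕ-injective (sym (trans p (+-identityʳ _))))))
  transition⇒shiftedFresh {m} (suc ℓ) {c} {c'} (c'' , step , rest)
    with transition⇒shiftedFresh ℓ rest
  ... | rest-shifted , rest-fresh = shifted , freshPrefix
    where
      -- v'_{i+ℓ+1} = v''_{i+1+ℓ} = v_i
      shifted : Shifted (suc ℓ) c c'
      shifted i j p with inject₁-preimage i (+suc<⇒< (subst (_< suc m) p (toℕ<n j)))
      ... | i₀ , refl =
        trans (rest-shifted (fs i₀) j (trans p (inject₁-+suc i₀ ℓ))) (oneTransition⇒shift {c = c} {c''} step i₀)

      -- a vertex pushed in a later move avoids v_j = v''_{j+1}; the vertex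
      -- pushed in the first move (now at position ℓ) avoids v_j by freshness
      freshPrefix : FreshPrefix (suc ℓ) c c'
      freshPrefix i j i≤ℓ lt with inject₁-preimage j (+suc-<⁻¹ (s≤s⁻¹ i≤ℓ) lt) | m<1+n⇒m<n∨m≡n i≤ℓ
      ... | j₀ , refl | inj₁ i<ℓ = λ e →
        rest-fresh i (fs j₀) i<ℓ (subst (_< suc m + toℕ i) (inject₁-+suc j₀ ℓ) lt)
          (trans e (sym (oneTransition⇒shift {c = c} {c''} step j₀)))
      ... | j₀ , refl | inj₂ i≡ℓ = λ e →
        oneTransition⇒fresh {c = c} {c''} step j₀ (trans (sym (rest-shifted fz i i≡ℓ)) e)

  -- Conversely, for ℓ < k every such pair is an ℓ-transition: the first move
  -- pushes v'_{ℓ-1}, which is adjacent to v'_ℓ = v_0 and fresh by FreshPrefix.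
  shiftedFresh⇒transition : ∀ {m} ℓ → ℓ ≤ m → {c c' : Configuration G (suc m)} →
    Shifted ℓ c c' → FreshPrefix ℓ c c' → Transition G ℓ c c'
  shiftedFresh⇒transition zero _ shifted _ = lift λ i → sym (shifted i i (sym (+-identityʳ _)))
  shiftedFresh⇒transition {m} (suc ℓ) ℓ<m {c} {c'} shifted freshPrefix =
    c'' , push-oneTransition c x adj fresh , shiftedFresh⇒transition ℓ (<⇒≤ ℓ<m) c''-shifted c''-fresh
    where
      L : Fin (suc m)
      L = fromℕ< (s≤s (<⇒≤ ℓ<m))

      toℕ-L : toℕ L ≡ ℓ
      toℕ-L = toℕ-fromℕ< (s≤s (<⇒≤ ℓ<m))

      L+1 : Fin (suc m)
      L+1 = fromℕ< (s≤s ℓ<m)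

      toℕ-L+1 : toℕ L+1 ≡ suc ℓ
      toℕ-L+1 = toℕ-fromℕ< (s≤s ℓ<m)

      x : Vertex
      x = vertex c' L

      adj : Adj x (vertex c fz)
      adj = subst (Adj x) (shifted fz L+1 toℕ-L+1)
                  (path c' L L+1 (trans toℕ-L+1 (cong suc (sym toℕ-L))))

      fresh : ∀ (j : Fin m) → x ≢ vertex c (inject₁ j)
      fresh j = freshPrefix L (inject₁ j) (subst (_< suc ℓ) (sym toℕ-L) ≤-refl)
                  (subst (λ n → toℕ (inject₁ j) + suc ℓ < suc m + n) (sym toℕ-L) (+suc-< (inject₁ℕ< j)))

      c'' : Configuration G (suc m)
      c'' = push c x adj fresh

      c''-shifted : Shifted ℓ c'' c'
      c''-shifted fz     j p = cong (vertex c') (toℕ-injective (trans p (sym toℕ-L)))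
      c''-shifted (fs i) j p = shifted (inject₁ i) j (trans p (sym (inject₁-+suc i ℓ)))

      -- position 0 of c'' holds v'_ℓ, distinct from v'_i for i < ℓ
      c''-fresh : FreshPrefix ℓ c'' c'
      c''-fresh i fz     i<ℓ _  e = <-irrefl (cong toℕ (distinct c' i L e)) (subst (toℕ i <_) (sym toℕ-L) i<ℓ)
      c''-fresh i (fs j) i<ℓ lt   = freshPrefix i (inject₁ j) (≤-trans i<ℓ (n≤1+n ℓ))
                                     (subst (_< suc m + toℕ i) (sym (inject₁-+suc j ℓ)) lt)

-- Corollary 3.2: the case ℓ = k - 1.  Shifted (k - 1) only relates v'_{k-1}
-- and v_0, and the FreshPrefix bound j + (k - 1) < k + i reads j ≤ i.
corollary3p2 : {a b : Level} (G : Graph a b) (k : ℕ) (c c' : Configuration G k) →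
    Transition G (k ∸ 1) c c' ⇔
      ((∀ (i j : Fin k) → suc (toℕ i) < k → toℕ j ≤ toℕ i → vertex c' i ≢ vertex c j)
       × (∀ (i j : Fin k) → suc (toℕ i) ≡ k → toℕ j ≡ 0 → vertex c' i ≡ vertex c j))
corollary3p2 G zero    c c' = mk⇔ (λ _ → (λ ()) , (λ ())) (λ _ → lift (λ ()))
corollary3p2 {a} G (suc m) c c' = mk⇔ to from
  where
    NoRevisit Closes : Set a
    NoRevisit = ∀ (i j : Fin (suc m)) → suc (toℕ i) < suc m → toℕ j ≤ toℕ i → vertex c' i ≢ vertex c j
    Closes    = ∀ (i j : Fin (suc m)) → suc (toℕ i) ≡ suc m → toℕ j ≡ 0 → vertex c' i ≡ vertex c j

    to : Transition G m c c' → NoRevisit × Closes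
    to t with transition⇒shiftedFresh G m t
    ... | shifted , freshPrefix =
          (λ i j i<m j≤i → freshPrefix i j (s≤s⁻¹ i<m) (≤⇒+-< j≤i))
        , (λ i j last j≡0 → shifted j i (trans (suc-injective last) (cong (_+ m) (sym j≡0))))

    from : NoRevisit × Closes → Transition G m c c'
    from (noRevisit , closes) = shiftedFresh⇒transition G m ≤-refl shifted freshPrefix
      where
        shifted : Shifted G m c c'
        shifted i j p = closes j i (cong suc (trans p (cong (_+ m) i≡0))) i≡0
          where
            i≡0 : toℕ i ≡ 0
            i≡0 = +-≤⇒0 (subst (_≤ m) p (s≤s⁻¹ (toℕ<n j)))

        freshPrefix : FreshPrefix G m c c'
        freshPrefix i j i<m lt = noRevisit i j (s≤s i<m) (+-<⇒≤ lt)
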